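{- For every simplicial complex $X$ on a finite set $V$ and every subset $S\subseteq V$, $\theta(X[S])\leq\theta(X)$, where $X[S]=\{A\in X: A\subseteq S\}$.
   Context: A simplicial complex $X$ on a finite set $V$ is a family of subsets of $V$ closed under taking subsets; its vertices are those $v$ with $\{v\}\in X$. For a vertex $v$, $\mathrm{del}(X;v)=\{S\in X:v\notin S\}$, $\mathrm{lk}(X;v)=\{T\in X:v\notin T,\ T\cup\{v\}\in X\}$; $v$ is a cone vertex if $\mathrm{lk}(X;v)=\mathrm{del}(X;v)$, and $V(X)^\circ$ is the set of non-cone vertices. Theta-number: $\theta(X)=0$ if $V(X)^\circ=\emptyset$, otherwise $\theta(X)=\min_{v\in V(X)^\circ}\max\{\theta(\mathrm{del}(X;v)),\theta(\mathrm{lk}(X;v))+1\}$. -}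

module Defs where

open import Data.Nat using (ℕ; zero; suc; _⊔_; _⊓_)
open import Data.Bool using (Bool; true; false; _∧_; if_then_else_)
open import Data.Fin using (Fin)
open import Data.Fin.Subset using (Subset; _⊆_; ⁅_⁆; inside; outside)
open import Data.Fin.Subset.Properties using (_⊆?_)
open import Data.Vec using (Vec; []; _∷_; insertAt)
open import Data.List using (List; []; _∷_; map; _++_; foldr)
open import Data.List using (allFin)
open import Relation.Nullary using (does)
open import Relation.Binary.PropositionalEquality using (_≡_)

Family : ℕ → Set
Family n = Subset n → Bool

IsSimplicialComplex : ∀ {n} → Family n → Set
IsSimplicialComplex {n} X = (A B : Subset n) → B ⊆ A → X A ≡ true → X B ≡ true

induced : ∀ {n} → Family n → Subset n → Family n
induced X S A = X A ∧ does (A ⊆? S)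

allSubsets : (n : ℕ) → List (Subset n)
allSubsets zero = [] ∷ []
allSubsets (suc n) = map (outside ∷_) (allSubsets n) ++ map (inside ∷_) (allSubsets n)

-- Deletion and link at v : Fin (suc n), as families on V ∖ {v} ≅ Fin n
-- (T ↦ T with v not added, resp. T ∪ {v}).
del : ∀ {n} → Family (suc n) → Fin (suc n) → Family n
del X v T = X (insertAt T v outside)

lk : ∀ {n} → Family (suc n) → Fin (suc n) → Family n
lk X v T = X (insertAt T v inside)

eqB : Bool → Bool → Bool
eqB true true = true
eqB false false = true
eqB _ _ = false

allB : ∀ {a} {A : Set a} → (A → Bool) → List A → Bool
allB p = foldr (λ x b → p x ∧ b) true

isVertex : ∀ {n} → Family n → Fin n → Bool
isVertex X v = X ⁅ v ⁆

isCone : ∀ {n} → Family (suc n) → Fin (suc n) → Bool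
isCone {n} X v = allB (λ T → eqB (lk X v T) (del X v T)) (allSubsets n)

isNonConeVertex : ∀ {n} → Family (suc n) → Fin (suc n) → Bool
isNonConeVertex X v = if isVertex X v then (if isCone X v then false else true) else false

minOr0 : List ℕ → ℕ
minOr0 [] = 0
minOr0 (x ∷ xs) = foldr _⊓_ x xs

collect : ∀ {a} {A : Set a} → (A → Bool) → (A → ℕ) → List A → List ℕ
collect p f [] = []
collect p f (x ∷ xs) = if p x then f x ∷ collect p f xs else collect p f xs

θ : (n : ℕ) → Family n → ℕ
θ zero X = 0
θ (suc n) X =
  minOr0 (collect (isNonConeVertex X)
                  (λ v → θ n (del X v) ⊔ suc (θ n (lk X v)))
                  (allFin (suc n)))

{-# OPTIONS --safe #-}
module Submission where

-- Deletion and link commute with passing to an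
-- induced subcomplex, so if v is a non-cone vertex of both X and X[S], the branch of
-- X[S] at v is bounded by the branch of X at v by the induction hypothesis.  If v is a
-- non-cone vertex of X but not of X[S], then in X[S] it is a cone vertex or lies in no
-- face, and deleting such a vertex never decreases θ; this is again an induction,
-- resting on the fact that deletions and links at distinct vertices commute.

open import Defs
open import Data.Nat using (ℕ; zero; suc; _≤_; _⊓_; _⊔_; z≤n; s≤s)
open import Data.Nat.Properties using (≤-refl; ≤-trans; ≤-reflexive; ⊓-sel; m≤n⇒m⊓o≤n; m≤n⇒o⊓m≤n; m≤m⊔n; ⊔-mono-≤)
open import Data.Bool using (Bool; true; false; _∧_)
open import Data.Bool.Properties using (¬-not)
open import Data.Fin using (Fin; punchIn; punchOut)
open import Data.Fin.Properties using (punchIn-punchOut)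
open import Data.Fin.Subset using (Subset; _∈_; _⊆_; ⁅_⁆; inside; outside) renaming (⊥ to ∅)
open import Data.Fin.Subset.Properties using (_⊆?_; x∈⁅x⁆; x∈⁅y⁆⇒x≡y)
open import Data.Vec using ([]; _∷_; insertAt; removeAt; lookup)
open import Data.Vec.Properties using (insertAt-lookup; insertAt-removeAt; []=⇒lookup; lookup⇒[]=)
open import Data.List using ([]; _∷_; map; allFin)
open import Data.List.Properties using (foldr-preservesᵒ)
open import Data.List.Membership.Propositional using () renaming (_∈_ to _∈ₗ_)
open import Data.List.Membership.Propositional.Properties using (∈-map⁺; ∈-++⁺ˡ; ∈-++⁺ʳ; ∈-allFin; foldr-selective)
open import Data.List.Relation.Unary.Any as Any using (Any; here; there)
open import Data.Product using (∃; _×_; _,_; proj₁; proj₂)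
open import Data.Sum using (_⊎_; inj₁; inj₂)
open import Function using (_∘_)
open import Relation.Nullary using (¬_; Dec; yes; does; contradiction)
open import Relation.Nullary.Decidable using (dec-true)
open import Relation.Binary.PropositionalEquality using (_≡_; _≢_; refl; sym; trans; cong; cong₂; subst; module ≡-Reasoning)

∧-trueˡ : ∀ {a b} → a ∧ b ≡ true → a ≡ true
∧-trueˡ {true} _ = refl

∧-trueʳ : ∀ {a b} → a ∧ b ≡ true → b ≡ true
∧-trueʳ {true} b≡true = b≡true

∧-true : ∀ {a b} → a ≡ true → b ≡ true → a ∧ b ≡ true
∧-true refl refl = refl

true⇔true⇒≡ : ∀ {a b} → (a ≡ true → b ≡ true) → (b ≡ true → a ≡ true) → a ≡ b
true⇔true⇒≡ {true} to _ = sym (to refl)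
true⇔true⇒≡ {false} {true} _ from = from refl
true⇔true⇒≡ {false} {false} _ _ = refl

eqB⇒≡ : ∀ {a b} → eqB a b ≡ true → a ≡ b
eqB⇒≡ {true} {true} _ = refl
eqB⇒≡ {false} {false} _ = refl

≡⇒eqB : ∀ {a b} → a ≡ b → eqB a b ≡ true
≡⇒eqB {true} refl = refl
≡⇒eqB {false} refl = refl

does⇒ : ∀ {P : Set} (P? : Dec P) → does P? ≡ true → P
does⇒ (yes p) _ = p

allB⇒ : ∀ {A : Set} {p : A → Bool} xs {x} → allB p xs ≡ true → x ∈ₗ xs → p x ≡ true
allB⇒ (y ∷ xs) all (here refl) = ∧-trueˡ all
allB⇒ {p = p} (y ∷ xs) all (there x∈xs) = allB⇒ xs (∧-trueʳ {p y} all) x∈xs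

⇒allB : ∀ {A : Set} {p : A → Bool} xs → (∀ x → p x ≡ true) → allB p xs ≡ true
⇒allB [] _ = refl
⇒allB (x ∷ xs) p≡true = ∧-true (p≡true x) (⇒allB xs p≡true)

allB-cong : ∀ {A : Set} {p q : A → Bool} xs → (∀ x → p x ≡ q x) → allB p xs ≡ allB q xs
allB-cong [] _ = refl
allB-cong (x ∷ xs) p≗q = cong₂ _∧_ (p≗q x) (allB-cong xs p≗q)

∈-allSubsets : ∀ {n} (T : Subset n) → T ∈ₗ allSubsets n
∈-allSubsets [] = here refl
∈-allSubsets {suc n} (outside ∷ T) = ∈-++⁺ˡ (∈-map⁺ (outside ∷_) (∈-allSubsets T))
∈-allSubsets {suc n} (inside ∷ T) =
  ∈-++⁺ʳ (map (outside ∷_) (allSubsets n)) (∈-map⁺ (inside ∷_) (∈-allSubsets T))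

minOr0-≤ : ∀ {xs e} → e ∈ₗ xs → minOr0 xs ≤ e
minOr0-≤ {x ∷ xs} {e} e∈ = foldr-preservesᵒ ⊓-≤ x xs (bound e∈)
  where
  ⊓-≤ : ∀ a b → a ≤ e ⊎ b ≤ e → a ⊓ b ≤ e
  ⊓-≤ a b (inj₁ a≤e) = m≤n⇒m⊓o≤n b a≤e
  ⊓-≤ a b (inj₂ b≤e) = m≤n⇒o⊓m≤n a b≤e
  bound : e ∈ₗ x ∷ xs → x ≤ e ⊎ Any (_≤ e) xs
  bound (here refl) = inj₁ ≤-refl
  bound (there e∈xs) = inj₂ (Any.map (≤-reflexive ∘ sym) e∈xs)

minOr0-∈ : ∀ x xs → minOr0 (x ∷ xs) ∈ₗ x ∷ xs
minOr0-∈ x xs with foldr-selective ⊓-sel x xs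
... | inj₁ min≡x = here min≡x
... | inj₂ min∈xs = there min∈xs

module _ {A : Set} (p : A → Bool) (f : A → ℕ) where

  ∈-collect⁺ : ∀ {xs x} → p x ≡ true → x ∈ₗ xs → f x ∈ₗ collect p f xs
  ∈-collect⁺ {y ∷ xs} px (here refl) rewrite px = here refl
  ∈-collect⁺ {y ∷ xs} px (there x∈xs) with p y
  ... | true = there (∈-collect⁺ px x∈xs)
  ... | false = ∈-collect⁺ px x∈xs

  ∈-collect⁻ : ∀ xs {e} → e ∈ₗ collect p f xs → ∃ λ x → p x ≡ true × e ≡ f x
  ∈-collect⁻ (y ∷ xs) e∈ with p y in py
  ∈-collect⁻ (y ∷ xs) (here refl) | true = y , py , refl
  ∈-collect⁻ (y ∷ xs) (there e∈) | true = ∈-collect⁻ xs e∈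
  ∈-collect⁻ (y ∷ xs) e∈ | false = ∈-collect⁻ xs e∈

  minOr0-collect-≤ : ∀ {xs x} → p x ≡ true → x ∈ₗ xs → minOr0 (collect p f xs) ≤ f x
  minOr0-collect-≤ px x∈xs = minOr0-≤ (∈-collect⁺ px x∈xs)

  minOr0-collect-attained : ∀ xs →
    ((∀ x → x ∈ₗ xs → p x ≡ false) × minOr0 (collect p f xs) ≡ 0) ⊎
    (∃ λ x → p x ≡ true × minOr0 (collect p f xs) ≡ f x)
  minOr0-collect-attained xs with collect p f xs in collected
  ... | [] = inj₁ (none , refl)
    where
    none : ∀ x → x ∈ₗ xs → p x ≡ false
    none x x∈xs with p x in px
    ... | false = refl
    ... | true with subst (f x ∈ₗ_) collected (∈-collect⁺ px x∈xs)
    ... | ()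
  ... | e ∷ es = inj₂ (∈-collect⁻ xs (subst (minOr0 (e ∷ es) ∈ₗ_) (sym collected) (minOr0-∈ e es)))

collect-cong : ∀ {A : Set} {p q : A → Bool} {f g : A → ℕ} xs →
  (∀ x → p x ≡ q x) → (∀ x → f x ≡ g x) → collect p f xs ≡ collect q g xs
collect-cong [] _ _ = refl
collect-cong (x ∷ xs) p≗q f≗g rewrite p≗q x | f≗g x | collect-cong xs p≗q f≗g = refl

θ-branch : ∀ {k} → Family (suc k) → Fin (suc k) → ℕ
θ-branch {k} X v = θ k (del X v) ⊔ suc (θ k (lk X v))

θ≤θ-branch : ∀ {k} (X : Family (suc k)) v → isNonConeVertex X v ≡ true → θ (suc k) X ≤ θ-branch X v
θ≤θ-branch X v ncv = minOr0-collect-≤ (isNonConeVertex X) (θ-branch X) ncv (∈-allFin v)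

θ-attained : ∀ {k} (X : Family (suc k)) →
  ((∀ v → isNonConeVertex X v ≡ false) × θ (suc k) X ≡ 0) ⊎
  (∃ λ v → isNonConeVertex X v ≡ true × θ (suc k) X ≡ θ-branch X v)
θ-attained {k} X with minOr0-collect-attained (isNonConeVertex X) (θ-branch X) (allFin (suc k))
... | inj₁ (none , θ≡0) = inj₁ ((λ v → none v (∈-allFin v)) , θ≡0)
... | inj₂ attained = inj₂ attained

θ≤θ-byBranches : ∀ {k m} (Z : Family (suc k)) (Y : Family (suc m)) →
  (∀ w → isNonConeVertex Z w ≡ true → ∃ λ u → isNonConeVertex Y u ≡ true) →
  (∀ u → isNonConeVertex Y u ≡ true → θ (suc k) Z ≤ θ-branch Y u) →
  θ (suc k) Z ≤ θ (suc m) Y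
θ≤θ-byBranches Z Y nonCone⇒nonCone ≤branch with θ-attained Y
... | inj₂ (u , ncv , θ≡branch) = subst (θ _ Z ≤_) (sym θ≡branch) (≤branch u ncv)
... | inj₁ (noneY , _) with θ-attained Z
...   | inj₁ (_ , θZ≡0) = subst (_≤ θ _ Y) (sym θZ≡0) z≤n
...   | inj₂ (w , ncv , _) with nonCone⇒nonCone w ncv
...     | u , ncvY = contradiction (trans (sym ncvY) (noneY u)) λ ()

nonCone-≡ : ∀ {k m} {X : Family (suc k)} {Y : Family (suc m)} {v w} →
  isVertex X v ≡ isVertex Y w → isCone X v ≡ isCone Y w → isNonConeVertex X v ≡ isNonConeVertex Y w
nonCone-≡ vertex≡ cone≡ rewrite vertex≡ | cone≡ = refl

θ-cong : ∀ n {X Y : Family n} → (∀ A → X A ≡ Y A) → θ n X ≡ θ n Y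
θ-cong zero _ = refl
θ-cong (suc n) {X} {Y} X≗Y =
  cong minOr0 (collect-cong (allFin (suc n)) (λ v → nonCone-≡ {X = X} {Y} (X≗Y _) (cone≡ v)) branch≡)
  where
  cone≡ : ∀ v → isCone X v ≡ isCone Y v
  cone≡ v = allB-cong (allSubsets n) (λ T → cong₂ eqB (X≗Y _) (X≗Y _))
  branch≡ : ∀ v → θ-branch X v ≡ θ-branch Y v
  branch≡ v = cong₂ _⊔_ (θ-cong n (λ _ → X≗Y _)) (cong suc (θ-cong n (λ _ → X≗Y _)))

-- The hypothesis says x ≤ y in the order outside < inside.
insertAt-⊆? : ∀ {n} (B A : Subset n) (v : Fin (suc n)) {x y} → (x ≡ inside → y ≡ inside) →
  does (insertAt B v x ⊆? insertAt A v y) ≡ does (B ⊆? A)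
insertAt-⊆? B A Fin.zero {outside} _ = refl
insertAt-⊆? B A Fin.zero {inside} {inside} _ = refl
insertAt-⊆? B A Fin.zero {inside} {outside} x≤y with x≤y refl
... | ()
insertAt-⊆? (outside ∷ B) (a ∷ A) (Fin.suc v) x≤y = insertAt-⊆? B A v x≤y
insertAt-⊆? (inside ∷ B) (inside ∷ A) (Fin.suc v) x≤y = insertAt-⊆? B A v x≤y
insertAt-⊆? (inside ∷ B) (outside ∷ A) (Fin.suc v) _ = refl

insertAt-⊆?-removeAt : ∀ {n} (T : Subset n) v (S : Subset (suc n)) {x} → (x ≡ inside → v ∈ S) →
  does (insertAt T v x ⊆? S) ≡ does (T ⊆? removeAt S v)
insertAt-⊆?-removeAt T v S {x} x⇒v∈S =
  subst (λ S′ → does (insertAt T v x ⊆? S′) ≡ does (T ⊆? removeAt S v)) (insertAt-removeAt S v)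
        (insertAt-⊆? T (removeAt S v) v ([]=⇒lookup ∘ x⇒v∈S))

insertAt-mono-⊆ : ∀ {n} {B A : Subset n} v x → B ⊆ A → insertAt B v x ⊆ insertAt A v x
insertAt-mono-⊆ {B = B} {A} v x B⊆A =
  does⇒ (insertAt B v x ⊆? insertAt A v x)
        (trans (insertAt-⊆? B A v (λ x≡in → x≡in)) (dec-true (B ⊆? A) B⊆A))

∈⇒⁅⁆⊆ : ∀ {n} {v : Fin n} {A} → v ∈ A → ⁅ v ⁆ ⊆ A
∈⇒⁅⁆⊆ {v = v} {A} v∈A u∈⁅v⁆ = subst (_∈ A) (sym (x∈⁅y⁆⇒x≡y v u∈⁅v⁆)) v∈A

⁅⁆⊆insertAt : ∀ {n} (v : Fin (suc n)) (T : Subset n) → ⁅ v ⁆ ⊆ insertAt T v inside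
⁅⁆⊆insertAt v T = ∈⇒⁅⁆⊆ (lookup⇒[]= v _ (insertAt-lookup T v inside))

⁅⁆≡insertAt-∅ : ∀ {n} (v : Fin (suc n)) → ⁅ v ⁆ ≡ insertAt ∅ v inside
⁅⁆≡insertAt-∅ Fin.zero = refl
⁅⁆≡insertAt-∅ {suc n} (Fin.suc v) = cong (outside ∷_) (⁅⁆≡insertAt-∅ v)

insertAt-∅ : ∀ {n} (v : Fin (suc n)) → insertAt ∅ v outside ≡ ∅
insertAt-∅ Fin.zero = refl
insertAt-∅ {suc n} (Fin.suc v) = cong (outside ∷_) (insertAt-∅ v)

-- v′ is the position of v after the entry at punchIn v u has been removed.
insertAt-swap : ∀ {j} (v : Fin (suc (suc j))) (u : Fin (suc j)) → ∃ λ (v′ : Fin (suc j)) →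
  ∀ (T : Subset j) x y → insertAt (insertAt T v′ x) (punchIn v u) y ≡ insertAt (insertAt T u y) v x
insertAt-swap Fin.zero u = Fin.zero , λ T x y → refl
insertAt-swap (Fin.suc v) Fin.zero = v , λ T x y → refl
insertAt-swap {suc j} (Fin.suc v) (Fin.suc u) with insertAt-swap v u
... | v′ , swap = Fin.suc v′ , λ { (t ∷ T) x y → cong (t ∷_) (swap T x y) }

IsCone : ∀ {n} → Family (suc n) → Fin (suc n) → Set
IsCone {n} X v = ∀ (T : Subset n) → lk X v T ≡ del X v T

isCone⇒IsCone : ∀ {n} (X : Family (suc n)) v → isCone X v ≡ true → IsCone X v
isCone⇒IsCone {n} X v isCone≡true T = eqB⇒≡ (allB⇒ (allSubsets n) isCone≡true (∈-allSubsets T))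

IsCone⇒isCone : ∀ {n} (X : Family (suc n)) v → IsCone X v → isCone X v ≡ true
IsCone⇒isCone {n} X v lk≗del = ⇒allB (allSubsets n) (λ T → ≡⇒eqB (lk≗del T))

-- For a simplicial complex these are exactly the vertices that are not non-cone vertices.
data Removable {n} (X : Family (suc n)) (v : Fin (suc n)) : Set where
  cone   : IsCone X v → Removable X v
  noFace : (∀ (T : Subset n) → lk X v T ≡ false) → Removable X v

removable-lk-resp : ∀ {n} {X : Family (suc n)} {v A B} → Removable X v →
  del X v A ≡ del X v B → lk X v A ≡ lk X v B
removable-lk-resp (cone lk≗del) del≡ = trans (lk≗del _) (trans del≡ (sym (lk≗del _)))
removable-lk-resp (noFace lk≗false) _ = trans (lk≗false _) (sym (lk≗false _))

nonCone⇒vertex∧¬cone : ∀ {n} (X : Family (suc n)) v → isNonConeVertex X v ≡ true →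
  isVertex X v ≡ true × isCone X v ≡ false
nonCone⇒vertex∧¬cone X v ncv with isVertex X v | isCone X v
... | true | false = refl , refl

vertex∧¬cone⇒nonCone : ∀ {n} (X : Family (suc n)) v → isVertex X v ≡ true → isCone X v ≡ false →
  isNonConeVertex X v ≡ true
vertex∧¬cone⇒nonCone X v vertex ¬cone rewrite vertex | ¬cone = refl

nonCone⇒¬removable : ∀ {n} {X : Family (suc n)} {v} → isNonConeVertex X v ≡ true → ¬ Removable X v
nonCone⇒¬removable {X = X} {v} ncv r with nonCone⇒vertex∧¬cone X v ncv | r
... | _ , ¬cone | cone lk≗del = contradiction (trans (sym ¬cone) (IsCone⇒isCone X v lk≗del)) λ ()
... | vertex , _ | noFace lk≗false =
  contradiction (trans (sym vertex) (trans (cong X (⁅⁆≡insertAt-∅ v)) (lk≗false ∅))) λ ()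

removable≢nonCone : ∀ {n} {X : Family (suc n)} {v w} → Removable X v → isNonConeVertex X w ≡ true → v ≢ w
removable≢nonCone r ncv refl = nonCone⇒¬removable ncv r

module Swap {j} (Y : Family (suc (suc j))) (v : Fin (suc (suc j))) (u : Fin (suc j)) where

  w : Fin (suc (suc j))
  w = punchIn v u

  v′ : Fin (suc j)
  v′ = proj₁ (insertAt-swap v u)

  swap : ∀ T x y → insertAt (insertAt T v′ x) w y ≡ insertAt (insertAt T u y) v x
  swap = proj₂ (insertAt-swap v u)

  -- slice outside and slice inside are del Y w and lk Y w.
  slice : Bool → Family (suc j)
  slice y T = Y (insertAt T w y)

  del-slice : ∀ y T → del (slice y) v′ T ≡ del Y v (insertAt T u y)
  del-slice y T = cong Y (swap T outside y)

  slice-removable : Removable Y v → ∀ y → Removable (slice y) v′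
  slice-removable (cone lk≗del) y = cone λ T →
    trans (cong Y (swap T inside y)) (trans (lk≗del _) (sym (del-slice y T)))
  slice-removable (noFace lk≗false) y = noFace λ T → trans (cong Y (swap T inside y)) (lk≗false _)

  vertex-≡ : isVertex Y w ≡ isVertex (del Y v) u
  vertex-≡ = cong Y (begin
    ⁅ w ⁆
      ≡⟨ ⁅⁆≡insertAt-∅ w ⟩
    insertAt ∅ w inside
      ≡⟨ cong (λ T → insertAt T w inside) (insertAt-∅ v′) ⟨
    insertAt (insertAt ∅ v′ outside) w inside
      ≡⟨ swap ∅ outside inside ⟩
    insertAt (insertAt ∅ u inside) v outside
      ≡⟨ cong (λ T → insertAt T v outside) (⁅⁆≡insertAt-∅ u) ⟨
    insertAt ⁅ u ⁆ v outside
      ∎)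
    where open ≡-Reasoning

  cone⇒cone : IsCone Y w → IsCone (del Y v) u
  cone⇒cone lk≗del T =
    trans (cong Y (sym (swap T outside inside))) (trans (lk≗del _) (cong Y (swap T outside outside)))

  cone⇐cone : Removable Y v → IsCone (del Y v) u → IsCone Y w
  cone⇐cone r lk≗del T =
    subst (λ T → lk Y w T ≡ del Y w T) (insertAt-removeAt T v′) (sliced (removeAt T v′) (lookup T v′))
    where
    at-v : ∀ T′ x → Y (insertAt (insertAt T′ u inside) v x) ≡ Y (insertAt (insertAt T′ u outside) v x)
    at-v T′ outside = lk≗del T′
    at-v T′ inside = removable-lk-resp r (lk≗del T′)
    sliced : ∀ T′ x → lk Y w (insertAt T′ v′ x) ≡ del Y w (insertAt T′ v′ x)
    sliced T′ x =
      trans (cong Y (swap T′ x inside)) (trans (at-v T′ x) (cong Y (sym (swap T′ x outside))))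

  nonCone-≡-del : Removable Y v → isNonConeVertex Y w ≡ isNonConeVertex (del Y v) u
  nonCone-≡-del r = nonCone-≡ {X = Y} {del Y v} vertex-≡ (true⇔true⇒≡
    (IsCone⇒isCone (del Y v) u ∘ cone⇒cone ∘ isCone⇒IsCone Y w)
    (IsCone⇒isCone Y w ∘ cone⇐cone r ∘ isCone⇒IsCone (del Y v) u))

θ≤θ-del : ∀ k (Y : Family (suc k)) v → Removable Y v → θ (suc k) Y ≤ θ k (del Y v)
θ≤θ-del zero Y v r with θ-attained Y
... | inj₁ (_ , θ≡0) = ≤-reflexive θ≡0
... | inj₂ (w , ncv , _) with punchOut (removable≢nonCone r ncv)
... | ()
θ≤θ-del (suc j) Y v r = θ≤θ-byBranches Y (del Y v) nonCone-del branch-≤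
  where
  nonCone-del : ∀ w → isNonConeVertex Y w ≡ true → ∃ λ u → isNonConeVertex (del Y v) u ≡ true
  nonCone-del w ncv =
    punchOut v≢w , trans (sym (Swap.nonCone-≡-del Y v (punchOut v≢w) r))
                         (subst (λ w → isNonConeVertex Y w ≡ true) (sym (punchIn-punchOut v≢w)) ncv)
    where
    v≢w : v ≢ w
    v≢w = removable≢nonCone r ncv

  branch-≤ : ∀ u → isNonConeVertex (del Y v) u ≡ true → θ (suc (suc j)) Y ≤ θ-branch (del Y v) u
  branch-≤ u ncv = ≤-trans (θ≤θ-branch Y w (trans (nonCone-≡-del r) ncv))
                           (⊔-mono-≤ (slice-≤ outside) (s≤s (slice-≤ inside)))
    where
    open Swap Y v u
    slice-≤ : ∀ y → θ (suc j) (slice y) ≤ θ j (λ T → del Y v (insertAt T u y))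
    slice-≤ y = ≤-trans (θ≤θ-del j (slice y) v′ (slice-removable r y))
                        (≤-reflexive (θ-cong j (del-slice y)))

insertAt-isComplex : ∀ {n} {X : Family (suc n)} → IsSimplicialComplex X → ∀ v x →
  IsSimplicialComplex (λ T → X (insertAt T v x))
insertAt-isComplex cx v x A B B⊆A A∈X = cx _ _ (insertAt-mono-⊆ v x B⊆A) A∈X

induced-isComplex : ∀ {n} {X : Family n} → IsSimplicialComplex X → ∀ S → IsSimplicialComplex (induced X S)
induced-isComplex {X = X} cx S A B B⊆A A∈X[S] =
  ∧-true (cx A B B⊆A (∧-trueˡ A∈X[S])) (dec-true (B ⊆? S) (A⊆S ∘ B⊆A))
  where
  A⊆S : A ⊆ S
  A⊆S = does⇒ (A ⊆? S) (∧-trueʳ {X A} A∈X[S])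

del-induced : ∀ {n} (X : Family (suc n)) S v T → del (induced X S) v T ≡ induced (del X v) (removeAt S v) T
del-induced X S v T = cong (X (insertAt T v outside) ∧_) (insertAt-⊆?-removeAt T v S λ ())

lk-induced : ∀ {n} (X : Family (suc n)) S v → v ∈ S → ∀ T →
  lk (induced X S) v T ≡ induced (lk X v) (removeAt S v) T
lk-induced X S v v∈S T = cong (X (insertAt T v inside) ∧_) (insertAt-⊆?-removeAt T v S λ _ → v∈S)

cone-induced : ∀ {n} (X : Family (suc n)) S v → v ∈ S → IsCone X v → IsCone (induced X S) v
cone-induced X S v v∈S lk≗del T = begin
  lk (induced X S) v T                       ≡⟨ lk-induced X S v v∈S T ⟩
  lk X v T ∧ does (T ⊆? removeAt S v)        ≡⟨ cong (_∧ _) (lk≗del T) ⟩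
  del X v T ∧ does (T ⊆? removeAt S v)       ≡⟨ del-induced X S v T ⟨
  del (induced X S) v T                      ∎
  where open ≡-Reasoning

nonCone-induced⇒∈ : ∀ {n} (X : Family (suc n)) S v → isNonConeVertex (induced X S) v ≡ true → v ∈ S
nonCone-induced⇒∈ X S v ncv =
  does⇒ (⁅ v ⁆ ⊆? S) (∧-trueʳ {X ⁅ v ⁆} (proj₁ (nonCone⇒vertex∧¬cone (induced X S) v ncv)))
        (x∈⁅x⁆ v)

nonCone-induced⇒nonCone : ∀ {n} (X : Family (suc n)) S v →
  isNonConeVertex (induced X S) v ≡ true → isNonConeVertex X v ≡ true
nonCone-induced⇒nonCone X S v ncv = vertex∧¬cone⇒nonCone X v (∧-trueˡ vertex) (¬-not notCone)
  where
  vertex : isVertex (induced X S) v ≡ true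
  vertex = proj₁ (nonCone⇒vertex∧¬cone (induced X S) v ncv)
  notCone : isCone X v ≢ true
  notCone isCone≡ = contradiction
    (trans (sym (proj₂ (nonCone⇒vertex∧¬cone (induced X S) v ncv)))
           (IsCone⇒isCone (induced X S) v
             (cone-induced X S v (nonCone-induced⇒∈ X S v ncv) (isCone⇒IsCone X v isCone≡))))
    λ ()

¬nonCone⇒removable : ∀ {n} {X : Family (suc n)} → IsSimplicialComplex X → ∀ v →
  isNonConeVertex X v ≡ false → Removable X v
¬nonCone⇒removable {X = X} cx v ¬ncv with isVertex X v in isVertex≡ | isCone X v in isCone≡
... | _ | true = cone (isCone⇒IsCone X v isCone≡)
¬nonCone⇒removable cx v () | true | false
... | false | false = noFace λ T →
  ¬-not λ face → contradiction (trans (sym isVertex≡) (cx _ _ (⁅⁆⊆insertAt v T) face)) λ ()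

proposition2 : (n : ℕ) (X : Family n) → IsSimplicialComplex X →
    (S : Subset n) → θ n (induced X S) ≤ θ n X
proposition2 zero X cx S = z≤n
proposition2 (suc m) X cx S =
  θ≤θ-byBranches (induced X S) X (λ v ncv → v , nonCone-induced⇒nonCone X S v ncv) branch-≤
  where
  del-≤ : ∀ v → θ m (del (induced X S) v) ≤ θ m (del X v)
  del-≤ v = ≤-trans (≤-reflexive (θ-cong m (del-induced X S v)))
                    (proposition2 m (del X v) (insertAt-isComplex cx v outside) (removeAt S v))
  lk-≤ : ∀ v → v ∈ S → θ m (lk (induced X S) v) ≤ θ m (lk X v)
  lk-≤ v v∈S = ≤-trans (≤-reflexive (θ-cong m (lk-induced X S v v∈S)))
                       (proposition2 m (lk X v) (insertAt-isComplex cx v inside) (removeAt S v))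
  branch-≤ : ∀ v → isNonConeVertex X v ≡ true → θ (suc m) (induced X S) ≤ θ-branch X v
  branch-≤ v _ with isNonConeVertex (induced X S) v in ncv
  ... | true = ≤-trans (θ≤θ-branch (induced X S) v ncv)
                       (⊔-mono-≤ (del-≤ v) (s≤s (lk-≤ v (nonCone-induced⇒∈ X S v ncv))))
  ... | false = ≤-trans (θ≤θ-del m (induced X S) v (¬nonCone⇒removable (induced-isComplex cx S) v ncv))
                        (≤-trans (del-≤ v) (m≤m⊔n _ _))
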